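{- Let $\omega$ and $n$ be positive integers with $n>3\omega-3$. There are no $\omega+1$ pairwise intersecting chords in $\mathcal{D}_{n,\omega}$.
   Context: For positive integers $\omega$ and $n$ with $n>3\omega-3$, the chord diagram $\mathcal D_{n,\omega}$ is defined as follows. Let $p_1, q_1, p_2, q_2, \dots , p_n , q_n$ be points on a circle in cyclic clockwise order. For each $i\in \{1,\dots,n\}$ and $j\in \{1,\dots,\omega-1\}$, let $\mathcal{C}_{i,j}$ consist of exactly $\lfloor \omega/(j+1) \rfloor$ coinciding open chords with endpoints $p_i$ and $q_{i+j}$ (indices taken modulo $n$). Then $\mathcal{D}_{n,\omega}$ is the collection $\bigcup_{i}\bigcup_{j} \mathcal{C}_{i,j}$, with coinciding chords counted as distinct elements. Chords are open segments, and two chords intersect iff these open segments intersect; in particular two coinciding chords intersect, while two chords sharing exactly one endpoint do not intersect. -}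

module Defs where

open import Data.Nat using (ℕ; zero; suc; _+_; _*_; _≤_; _<_; _⊔_; _⊓_)
open import Data.Nat.DivMod using (_/_; _%_)
open import Data.Fin using (Fin; toℕ)
open import Data.Product using (_×_)
open import Data.Sum using (_⊎_)
open import Relation.Binary.PropositionalEquality using (_≡_; _≢_)
open import Relation.Nullary using (¬_)

-- Points p_0,q_0,p_1,q_1,...,p_{n-1},q_{n-1} in clockwise cyclic order are
-- encoded by positions 0,1,...,2n-1: p_i ↦ 2i, q_m ↦ 2m+1 (indices 0-based).

-- A chord of D_{n,ω}: it belongs to C_{i,j} with i = start, j = len
-- (1 ≤ j ≤ ω-1), and copy distinguishes the ⌊ω/(j+1)⌋ coinciding copies.
record Chord (n ω : ℕ) : Set where
  constructor chord
  field
    start : Fin n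
    len   : ℕ
    len≥1 : 1 ≤ len
    len<ω : len < ω
    copy  : Fin (ω / suc len)

open Chord public

qIndex : {n : ℕ} → Fin n → ℕ → ℕ
qIndex {suc m} i l = (toℕ i + l) % suc m

pPos : {n ω : ℕ} → Chord n ω → ℕ
pPos c = 2 * toℕ (start c)

qPos : {n ω : ℕ} → Chord n ω → ℕ
qPos c = 2 * qIndex (start c) (len c) + 1

StrictlyBetween : ℕ → ℕ → ℕ → Set
StrictlyBetween a b x = (a ⊓ b < x) × (x < a ⊔ b)

-- Two open chords intersect iff they coincide (same endpoints) or
-- they have four distinct endpoints which interleave on the circle.
Coincide : {n ω : ℕ} → Chord n ω → Chord n ω → Set
Coincide c d = (pPos c ≡ pPos d) × (qPos c ≡ qPos d)

Cross : {n ω : ℕ} → Chord n ω → Chord n ω → Set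
Cross c d =
  (pPos c ≢ pPos d) × (qPos c ≢ qPos d) ×
  ( (StrictlyBetween (pPos c) (qPos c) (pPos d) × ¬ StrictlyBetween (pPos c) (qPos c) (qPos d))
  ⊎ (¬ StrictlyBetween (pPos c) (qPos c) (pPos d) × StrictlyBetween (pPos c) (qPos c) (qPos d)))

Intersect : {n ω : ℕ} → Chord n ω → Chord n ω → Set
Intersect c d = Coincide c d ⊎ Cross c d

-- Let c be a shortest chord, of length j, among ω + 1 pairwise intersecting chords, and measure
-- positions clockwise from the p-end of c. Every other chord either coincides with c or has
-- exactly one endpoint strictly inside the arc of c: a p-end at offset a ∈ [1, j] or a q-end at
-- offset a − 1 ∈ [0, j − 1]; give it the slot a, and a chord coinciding with c the slot 0.
-- Chords in the same slot coincide: if they share an endpoint this holds for any two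
-- intersecting chords, and a chord with its q-end just before the p-end of another cannot
-- cross it, because then the arcs of the two chords and of c would cover the whole circle,
-- forcing n ≤ 3ω − 3. Coinciding chords have equal length ≥ j, hence at most ⌊ω/(j+1)⌋ copies,
-- so the map chord ↦ (slot, copy) injects ω + 1 chords into (j + 1)⌊ω/(j+1)⌋ ≤ ω labels.

module Submission where

open import Data.Empty using (⊥)
open import Data.Fin as F using (Fin; toℕ; fromℕ<; inject≤; combine)
import Data.Fin.Properties as Fₚ
open import Data.Nat using (ℕ; zero; suc; _+_; _*_; _∸_; _≤_; _<_; _≤?_; _<?_; z≤n; s≤s; s≤s⁻¹; NonZero)
open import Data.Nat.DivMod
  using (_%_; _/_; m%n<n; m<n⇒m%n≡m; [m+n]%n≡m%n; m≤n⇒[n∸m]%m≡n%m; /-monoʳ-≤; m/n*n≤m)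
open import Data.Nat.Properties
open import Data.Nat.Tactic.RingSolver using (solve-∀)
open import Data.Product using (Σ; _×_; _,_; proj₁; proj₂)
open import Data.Sum using (_⊎_; inj₁; inj₂)
open import Function using (_∘_)
open import Function.Bundles using (_⇔_; mk⇔; Equivalence)
open import Function.Definitions using (Injective)
import Function.Properties.Equivalence as ⇔
open import Relation.Binary using (tri<; tri≈; tri>)
open import Relation.Binary.PropositionalEquality
open import Relation.Nullary using (¬_; Dec; yes; no; contradiction)
open import Relation.Nullary.Decidable using (decidable-stable)
open import Defs

open Equivalence using (to; from)

private
  variable
    A A′ B B′ : Set

arc : ℕ → ℕ → ℕ → ℕ
arc M x y with x ≤? y
... | yes _ = y ∸ x
... | no  _ = y + M ∸ x

arc-cases : ∀ M {x y} → x ≤ M →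
            (x ≤ y × arc M x y + x ≡ y) ⊎ (y < x × arc M x y + x ≡ y + M)
arc-cases M {x} {y} x≤M with x ≤? y
... | yes x≤y = inj₁ (x≤y , m∸n+n≡m x≤y)
... | no  x≰y = inj₂ (≰⇒> x≰y , m∸n+n≡m (≤-trans x≤M (m≤n+m M y)))

arc-≤ : ∀ M {x y} → x ≤ M → x ≤ y → arc M x y + x ≡ y
arc-≤ M x≤M x≤y with arc-cases M x≤M
... | inj₁ (_ , eq)   = eq
... | inj₂ (y<x , _)  = contradiction x≤y (<⇒≱ y<x)

arc-> : ∀ M {x y} → x ≤ M → y < x → arc M x y + x ≡ y + M
arc-> M x≤M y<x with arc-cases M x≤M
... | inj₁ (x≤y , _) = contradiction x≤y (<⇒≱ y<x)
... | inj₂ (_ , eq)  = eq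

arc-unique : ∀ M {x y r} → x ≤ M → r + x ≡ y → arc M x y ≡ r
arc-unique M {x} {y} {r} x≤M eq with arc-cases M {x} {y} x≤M
... | inj₁ (_ , eq′)  = +-cancelʳ-≡ x _ _ (trans eq′ (sym eq))
... | inj₂ (y<x , _)  = contradiction (subst (x ≤_) eq (m≤n+m x r)) (<⇒≱ y<x)

arc-unique-wrap : ∀ M {x y r} → x ≤ M → y < x → r + x ≡ y + M → arc M x y ≡ r
arc-unique-wrap M {x} {y} x≤M y<x eq = +-cancelʳ-≡ x _ _ (trans (arc-> M x≤M y<x) (sym eq))

arc<M : ∀ M {x y} → x < M → y < M → arc M x y < M
arc<M M {x} {y} x<M y<M with arc-cases M {x} {y} (<⇒≤ x<M)
... | inj₁ (_ , eq)   = ≤-<-trans (m≤m+n _ x) (subst (_< M) (sym eq) y<M)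
... | inj₂ (y<x , eq) = +-cancelʳ-< x _ M
  (subst₂ _<_ (sym eq) (+-comm x M) (+-monoˡ-< M y<x))

arc-self : ∀ M {x} → x ≤ M → arc M x x ≡ 0
arc-self M x≤M = arc-unique M x≤M refl

arc-injective : ∀ M .{{_ : NonZero M}} {c y y′} → c < M → y < M → y′ < M →
                arc M c y ≡ arc M c y′ → y ≡ y′
arc-injective M {c} c<M y<M y′<M eq =
  trans (sym (recover y<M)) (trans (cong (λ r → (r + c) % M) eq) (recover y′<M))
  where
  recover : ∀ {z} → z < M → (arc M c z + c) % M ≡ z
  recover {z} z<M with arc-cases M {c} {z} (<⇒≤ c<M)
  ... | inj₁ (_ , e) = trans (cong (_% M) e) (m<n⇒m%n≡m z<M)
  ... | inj₂ (_ , e) = trans (cong (_% M) e) (trans ([m+n]%n≡m%n z M) (m<n⇒m%n≡m z<M))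

arc-mod : ∀ n .{{_ : NonZero n}} {s l} → s < n → l < n → arc n s ((s + l) % n) ≡ l
arc-mod n {s} {l} s<n l<n with s + l <? n
... | yes s+l<n = arc-unique n (<⇒≤ s<n) (trans (+-comm l s) (sym (m<n⇒m%n≡m s+l<n)))
... | no  s+l≮n = arc-unique-wrap n (<⇒≤ s<n) wrapped<s wraps
  where
  n≤s+l : n ≤ s + l
  n≤s+l = ≮⇒≥ s+l≮n
  wrapped : (s + l) % n ≡ s + l ∸ n
  wrapped = trans (sym (m≤n⇒[n∸m]%m≡n%m n≤s+l))
                  (m<n⇒m%n≡m (m<n+o⇒m∸n<o (s + l) n (+-mono-< s<n l<n)))
  wrapped<s : (s + l) % n < s
  wrapped<s = subst₂ _<_ (sym wrapped) (m+n∸n≡m s n) (∸-monoˡ-< (+-monoʳ-< s l<n) n≤s+l)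
  wraps : l + s ≡ (s + l) % n + n
  wraps = trans (+-comm l s) (sym (trans (cong (_+ n) wrapped) (m∸n+n≡m n≤s+l)))

private
  cancel-wrap : ∀ r a {y} M → r + (a + M) ≡ y + M → r + a ≡ y
  cancel-wrap r a M eq = +-cancelʳ-≡ M _ _ (trans (+-assoc r a M) eq)

arc-trans : ∀ M {c a x} → c < M → a < M → x < M → arc M c a ≤ arc M c x →
            arc M a x + arc M c a ≡ arc M c x
arc-trans M {c} {a} {x} c<M a<M x<M Ra≤Rx = trans (cong (_+ Ra) arc≡r) (m∸n+n≡m Ra≤Rx)
  where
  Ra = arc M c a
  Rx = arc M c x
  r  = Rx ∸ Ra
  shift : ∀ {a′ x′} → Ra + c ≡ a′ → Rx + c ≡ x′ → r + a′ ≡ x′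
  shift refl refl = trans (sym (+-assoc r Ra c)) (cong (_+ c) (m∸n+n≡m Ra≤Rx))
  arc≡r : arc M a x ≡ r
  arc≡r with arc-cases M {c} {a} (<⇒≤ c<M) | arc-cases M {c} {x} (<⇒≤ c<M)
  ... | inj₁ (_ , ea)   | inj₁ (_ , ex)   = arc-unique M (<⇒≤ a<M) (shift ea ex)
  ... | inj₁ (c≤a , ea) | inj₂ (x<c , ex) = arc-unique-wrap M (<⇒≤ a<M) (<-≤-trans x<c c≤a) (shift ea ex)
  ... | inj₂ (_ , ea)   | inj₁ (_ , ex)   =
    contradiction (subst₂ _≤_ ea ex (+-monoˡ-≤ c Ra≤Rx)) (<⇒≱ (<-≤-trans x<M (m≤n+m M a)))
  ... | inj₂ (_ , ea)   | inj₂ (_ , ex)   = arc-unique M (<⇒≤ a<M) (cancel-wrap r a M (shift ea ex))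

arc-trans-wrap : ∀ M {c a x} → c < M → a < M → x < M → arc M c x < arc M c a →
                 arc M a x + arc M c a ≡ arc M c x + M
arc-trans-wrap M {c} {a} {x} c<M a<M x<M Rx<Ra = trans (cong (_+ Ra) arc≡r) (m∸n+n≡m Ra≤Rx+M)
  where
  Ra = arc M c a
  Rx = arc M c x
  Ra≤Rx+M : Ra ≤ Rx + M
  Ra≤Rx+M = ≤-trans (<⇒≤ (arc<M M c<M a<M)) (m≤n+m M Rx)
  r  = Rx + M ∸ Ra
  shift : ∀ {a′ x′} → Ra + c ≡ a′ → Rx + c ≡ x′ → r + a′ ≡ x′ + M
  shift refl refl = begin
    r + (Ra + c)  ≡⟨ +-assoc r Ra c ⟨
    r + Ra + c    ≡⟨ cong (_+ c) (m∸n+n≡m Ra≤Rx+M) ⟩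
    Rx + M + c    ≡⟨ +-swap Rx M c ⟩
    Rx + c + M    ∎
    where
    open ≡-Reasoning
    +-swap : ∀ a b c → a + b + c ≡ a + c + b
    +-swap = solve-∀
  ordered : ∀ {a′ x′} → Ra + c ≡ a′ → Rx + c ≡ x′ → x′ < a′
  ordered ea ex = subst₂ _<_ ex ea (+-monoˡ-< c Rx<Ra)
  arc≡r : arc M a x ≡ r
  arc≡r with arc-cases M {c} {a} (<⇒≤ c<M) | arc-cases M {c} {x} (<⇒≤ c<M)
  ... | inj₁ (_ , ea) | inj₁ (_ , ex) = arc-unique-wrap M (<⇒≤ a<M) (ordered ea ex) (shift ea ex)
  ... | inj₁ (_ , ea) | inj₂ (_ , ex) =
    contradiction (ordered ea ex) (<⇒≯ (<-≤-trans a<M (m≤n+m M x)))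
  ... | inj₂ (_ , ea) | inj₁ (_ , ex) = arc-unique M (<⇒≤ a<M) (cancel-wrap r a M (shift ea ex))
  ... | inj₂ (_ , ea) | inj₂ (_ , ex) =
    arc-unique-wrap M (<⇒≤ a<M) (+-cancelʳ-< M _ _ (ordered ea ex)) (cancel-wrap r a M (shift ea ex))

private
  double-+ : ∀ r b x → 2 * r + b + 2 * x ≡ 2 * (r + x) + b
  double-+ = solve-∀

arc-double : ∀ n {x y b} → x < n → b < 2 →
             arc (2 * n) (2 * x) (2 * y + b) ≡ 2 * arc n x y + b
arc-double n {x} {y} {b} x<n b<2 with arc-cases n {x} {y} (<⇒≤ x<n)
... | inj₁ (_ , eq) = arc-unique (2 * n) (*-monoʳ-≤ 2 (<⇒≤ x<n))
  (trans (double-+ (arc n x y) b x) (cong (λ z → 2 * z + b) eq))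
... | inj₂ (y<x , eq) = arc-unique-wrap (2 * n) (*-monoʳ-≤ 2 (<⇒≤ x<n)) 2y+b<2x
  (trans (double-+ (arc n x y) b x) (trans (cong (λ z → 2 * z + b) eq) (sym (double-+ y b n))))
  where
  2y+b<2x : 2 * y + b < 2 * x
  2y+b<2x = <-≤-trans (+-monoʳ-< (2 * y) b<2)
              (subst (_≤ 2 * x) (trans (*-suc 2 y) (+-comm 2 (2 * y))) (*-monoʳ-≤ 2 y<x))

arc-double-even : ∀ n {x y} → x < n → arc (2 * n) (2 * x) (2 * y) ≡ 2 * arc n x y
arc-double-even n {x} x<n =
  subst₂ (λ u v → arc (2 * n) (2 * x) u ≡ v) (+-identityʳ _) (+-identityʳ _) (arc-double n x<n (s≤s z≤n))

Xor : Set → Set → Set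
Xor A B = (A × ¬ B) ⊎ (¬ A × B)

Xor-map : A ⇔ A′ → B ⇔ B′ → Xor A B → Xor A′ B′
Xor-map A⇔A′ B⇔B′ (inj₁ (a , ¬b)) = inj₁ (to A⇔A′ a , ¬b ∘ from B⇔B′)
Xor-map A⇔A′ B⇔B′ (inj₂ (¬a , b)) = inj₂ (¬a ∘ from A⇔A′ , to B⇔B′ b)

Xor-¬ : Dec A → Dec B → Xor (¬ A) (¬ B) → Xor A B
Xor-¬ A? B? (inj₁ (¬a , ¬¬b)) = inj₂ (¬a , decidable-stable B? ¬¬b)
Xor-¬ A? B? (inj₂ (¬¬a , ¬b)) = inj₁ (decidable-stable A? ¬¬a , ¬b)

between-≤ : ∀ {P Q x} → P ≤ Q → StrictlyBetween P Q x ⇔ (P < x × x < Q)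
between-≤ P≤Q = mk⇔
  (λ (l , r) → subst (_< _) (m≤n⇒m⊓n≡m P≤Q) l , subst (_ <_) (m≤n⇒m⊔n≡n P≤Q) r)
  (λ (l , r) → subst (_< _) (sym (m≤n⇒m⊓n≡m P≤Q)) l , subst (_ <_) (sym (m≤n⇒m⊔n≡n P≤Q)) r)

between-≥ : ∀ {P Q x} → Q ≤ P → StrictlyBetween P Q x ⇔ (Q < x × x < P)
between-≥ Q≤P = mk⇔
  (λ (l , r) → subst (_< _) (m≥n⇒m⊓n≡n Q≤P) l , subst (_ <_) (m≥n⇒m⊔n≡m Q≤P) r)
  (λ (l , r) → subst (_< _) (sym (m≥n⇒m⊓n≡n Q≤P)) l , subst (_ <_) (sym (m≥n⇒m⊔n≡m Q≤P)) r)

interval⇔arc< : ∀ M {P Q x} → P < Q → Q < M → x ≢ P →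
                (P < x × x < Q) ⇔ arc M P x < arc M P Q
interval⇔arc< M {P} {Q} {x} P<Q Q<M x≢P = mk⇔ inside inside⁻¹
  where
  P≤M  = <⇒≤ (<-trans P<Q Q<M)
  arcQ = arc-≤ M P≤M (<⇒≤ P<Q)
  inside : P < x × x < Q → arc M P x < arc M P Q
  inside (P<x , x<Q) = +-cancelʳ-< P _ _ (subst₂ _<_ (sym (arc-≤ M P≤M (<⇒≤ P<x))) (sym arcQ) x<Q)
  inside⁻¹ : arc M P x < arc M P Q → P < x × x < Q
  inside⁻¹ lt with arc-cases M {P} {x} P≤M
  ... | inj₁ (P≤x , eq) = ≤∧≢⇒< P≤x (x≢P ∘ sym) , subst₂ _<_ eq arcQ (+-monoˡ-< P lt)
  ... | inj₂ (_ , eq) =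
    contradiction (m≤n+m M x) (<⇒≱ (<-trans (subst₂ _<_ eq arcQ (+-monoˡ-< P lt)) Q<M))

interval⇔arc≮ : ∀ M {P Q x} → Q < P → P < M → x < M → x ≢ Q →
                (Q < x × x < P) ⇔ (¬ arc M P x < arc M P Q)
interval⇔arc≮ M {P} {Q} {x} Q<P P<M x<M x≢Q = mk⇔ outside outside⁻¹
  where
  P≤M  = <⇒≤ P<M
  arcQ = arc-> M P≤M Q<P
  outside : Q < x × x < P → ¬ arc M P x < arc M P Q
  outside (Q<x , x<P) lt =
    <-asym Q<x (+-cancelʳ-< M _ _ (subst₂ _<_ (arc-> M P≤M x<P) arcQ (+-monoˡ-< P lt)))
  outside⁻¹ : ¬ arc M P x < arc M P Q → Q < x × x < P
  outside⁻¹ ≮ with arc-cases M {P} {x} P≤M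
  ... | inj₁ (_ , eq) =
    contradiction (+-cancelʳ-< P _ _ (subst₂ _<_ (sym eq) (sym arcQ) (<-≤-trans x<M (m≤n+m M Q)))) ≮
  ... | inj₂ (x<P , eq) =
    ≤∧≢⇒< (+-cancelʳ-≤ M Q x (subst₂ _≤_ arcQ eq (+-monoˡ-≤ P (≮⇒≥ ≮)))) (x≢Q ∘ sym) , x<P

-- For P < Q the clockwise arc from P to Q is the interval (P, Q); for Q < P it is the
-- complement of [Q, P], hence the negations.
separates⇒arc-separates :
  ∀ M {P Q u v} → P ≢ Q → P < M → Q < M → u < M → v < M → u ≢ P → u ≢ Q → v ≢ P → v ≢ Q →
  Xor (StrictlyBetween P Q u) (StrictlyBetween P Q v) →
  Xor (arc M P u < arc M P Q) (arc M P v < arc M P Q)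
separates⇒arc-separates M {P} {Q} {u} {v} P≢Q P<M Q<M u<M v<M u≢P u≢Q v≢P v≢Q with <-cmp P Q
... | tri< P<Q _ _ = Xor-map (⇔.trans (between-≤ (<⇒≤ P<Q)) (interval⇔arc< M P<Q Q<M u≢P))
                             (⇔.trans (between-≤ (<⇒≤ P<Q)) (interval⇔arc< M P<Q Q<M v≢P))
... | tri≈ _ P≡Q _ = contradiction P≡Q P≢Q
... | tri> _ _ Q<P = Xor-¬ (_ <? _) (_ <? _)
  ∘ Xor-map (⇔.trans (between-≥ (<⇒≤ Q<P)) (interval⇔arc≮ M Q<P P<M u<M u≢Q))
            (⇔.trans (between-≥ (<⇒≤ Q<P)) (interval⇔arc≮ M Q<P P<M v<M v≢Q))

m,n,o<ω⇒m+n+o≤3ω∸3 : ∀ {ω m n o} → m < ω → n < ω → o < ω → m + n + o ≤ 3 * ω ∸ 3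
m,n,o<ω⇒m+n+o≤3ω∸3 {ω} {m} {n} {o} m<ω n<ω o<ω =
  m+n≤o⇒m≤o∸n (m + n + o)
    (subst (_≤ 3 * ω) (shuffle m n o) (+-mono-≤ m<ω (+-mono-≤ n<ω (+-mono-≤ o<ω z≤n))))
  where
  shuffle : ∀ m n o → suc m + (suc n + (suc o + 0)) ≡ m + n + o + 3
  shuffle = solve-∀

2m<2n+1⇔m≤n : ∀ {m n} → 2 * m < 2 * n + 1 ⇔ m ≤ n
2m<2n+1⇔m≤n {m} {n} = mk⇔
  (λ lt → *-cancelˡ-≤ 2 (s≤s⁻¹ (subst (2 * m <_) (+-comm (2 * n) 1) lt)))
  (λ le → subst (2 * m <_) (+-comm 1 (2 * n)) (s≤s (*-monoʳ-≤ 2 le)))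

2m+1<2n+1⇔m<n : ∀ {m n} → 2 * m + 1 < 2 * n + 1 ⇔ m < n
2m+1<2n+1⇔m<n {m} {n} = mk⇔
  (λ lt → *-cancelˡ-< 2 m n (+-cancelʳ-< 1 _ _ lt))
  (λ lt → +-monoˡ-< 1 (*-monoʳ-< 2 lt))

module _ {ω m : ℕ} where
  private
    n : ℕ
    n = suc m

  pEnd qEnd : Chord n ω → ℕ
  pEnd d = toℕ (start d)
  qEnd d = qIndex (start d) (len d)

  pEnd<n : (d : Chord n ω) → pEnd d < n
  pEnd<n d = Fₚ.toℕ<n (start d)

  qEnd<n : (d : Chord n ω) → qEnd d < n
  qEnd<n d = m%n<n (pEnd d + len d) n

  len<n : 3 * ω ∸ 3 < n → (d : Chord n ω) → len d < n
  len<n n>3ω-3 d = ≤-<-trans (≤-trans (≤-trans (m≤m+n l l) (m≤m+n (l + l) l)) l+l+l≤) n>3ω-3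
    where
    l = len d
    l+l+l≤ : l + l + l ≤ 3 * ω ∸ 3
    l+l+l≤ = m,n,o<ω⇒m+n+o≤3ω∸3 (len<ω d) (len<ω d) (len<ω d)

  offset : Chord n ω → ℕ → ℕ
  offset c = arc n (pEnd c)

  offset-injective : ∀ c {y y′} → y < n → y′ < n → offset c y ≡ offset c y′ → y ≡ y′
  offset-injective c = arc-injective n (pEnd<n c)

  offset-qEnd : ∀ d → len d < n → offset d (qEnd d) ≡ len d
  offset-qEnd d = arc-mod n (pEnd<n d)

  pPos≢qPos : ∀ d e → pPos d ≢ qPos e
  pPos≢qPos d e eq = even≢odd (pEnd d) (qEnd e) (trans eq (+-comm _ 1))

  coincide⇒≡ends : ∀ {d e} → Coincide d e → pEnd d ≡ pEnd e × qEnd d ≡ qEnd e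
  coincide⇒≡ends (p≡ , q≡) = *-cancelˡ-≡ _ _ 2 p≡ , *-cancelˡ-≡ _ _ 2 (+-cancelʳ-≡ 1 _ _ q≡)

  ≡pEnd⇒coincide : ∀ {d e} → Intersect d e → pEnd d ≡ pEnd e → Coincide d e
  ≡pEnd⇒coincide (inj₁ coincide)    _  = coincide
  ≡pEnd⇒coincide (inj₂ (p≢ , _ , _)) eq = contradiction (cong (2 *_) eq) p≢

  ≡qEnd⇒coincide : ∀ {d e} → Intersect d e → qEnd d ≡ qEnd e → Coincide d e
  ≡qEnd⇒coincide (inj₁ coincide)    _  = coincide
  ≡qEnd⇒coincide (inj₂ (_ , q≢ , _)) eq = contradiction (cong (λ z → 2 * z + 1) eq) q≢

  cross⇒arc-separates : ∀ {d e} → len d < n → Cross d e →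
    Xor (offset d (pEnd e) ≤ len d) (offset d (qEnd e) < len d)
  cross⇒arc-separates {d} {e} len<n (p≢ , q≢ , separated) =
    Xor-map 2m<2n+1⇔m≤n 2m+1<2n+1⇔m<n
      (subst₂ (λ u v → Xor (u < 2 * len d + 1) (v < 2 * len d + 1)) eP eQe
        (subst (λ w → Xor (arcᵈ (pPos e) < w) (arcᵈ (qPos e) < w)) eQd arcs))
    where
    M = 2 * n
    arcᵈ = arc M (pPos d)
    pPos< : ∀ e → pPos e < M
    pPos< e = *-monoʳ-< 2 (pEnd<n e)
    qPos< : ∀ e → qPos e < M
    qPos< e = subst (_≤ M) (trans (*-suc 2 (qEnd e)) (trans (+-comm 2 (2 * qEnd e)) (+-suc _ 1)))
                    (*-monoʳ-≤ 2 (qEnd<n e))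
    arcs : Xor (arcᵈ (pPos e) < arcᵈ (qPos d)) (arcᵈ (qPos e) < arcᵈ (qPos d))
    arcs = separates⇒arc-separates M (pPos≢qPos d d) (pPos< d) (qPos< d) (pPos< e) (qPos< e)
      (p≢ ∘ sym) (pPos≢qPos e d) (pPos≢qPos d e ∘ sym) (q≢ ∘ sym) separated
    eP : arcᵈ (pPos e) ≡ 2 * offset d (pEnd e)
    eP = arc-double-even n (pEnd<n d)
    eQe : arcᵈ (qPos e) ≡ 2 * offset d (qEnd e) + 1
    eQe = arc-double n (pEnd<n d) (s≤s (s≤s z≤n))
    eQd : arcᵈ (qPos d) ≡ 2 * len d + 1
    eQd = trans (arc-double n (pEnd<n d) (s≤s (s≤s z≤n)))
                (cong (λ z → 2 * z + 1) (offset-qEnd d len<n))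

  chord-≡ : ∀ {d e : Chord n ω} → start d ≡ start e → len d ≡ len e →
            toℕ (copy d) ≡ toℕ (copy e) → d ≡ e
  chord-≡ {chord s l p q k} {chord .s .l p′ q′ k′} refl refl k≡k′
    rewrite ≤-irrelevant p p′ | ≤-irrelevant q q′ | Fₚ.toℕ-injective k≡k′ = refl

  coincide⇒≡ : 3 * ω ∸ 3 < n → ∀ {d e} → Coincide d e → toℕ (copy d) ≡ toℕ (copy e) → d ≡ e
  coincide⇒≡ n>3ω-3 {d} {e} coincide = chord-≡ (Fₚ.toℕ-injective p≡) len≡
    where
    p≡ = proj₁ (coincide⇒≡ends {d} {e} coincide)
    q≡ = proj₂ (coincide⇒≡ends {d} {e} coincide)
    len≡ : len d ≡ len e
    len≡ = trans (sym (offset-qEnd d (len<n n>3ω-3 d)))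
                 (trans (cong₂ (arc n) p≡ q≡) (offset-qEnd e (len<n n>3ω-3 e)))

  len+offset : ∀ {c d} → len d < n → offset c (pEnd d) ≤ offset c (qEnd d) →
               len d + offset c (pEnd d) ≡ offset c (qEnd d)
  len+offset {c} {d} len<n ≤ =
    trans (cong (_+ offset c (pEnd d)) (sym (offset-qEnd d len<n)))
          (arc-trans n (pEnd<n c) (pEnd<n d) (qEnd<n d) ≤)

  len+offset-wrap : ∀ {c d} → len d < n → offset c (qEnd d) < offset c (pEnd d) →
                    len d + offset c (pEnd d) ≡ offset c (qEnd d) + n
  len+offset-wrap {c} {d} len<n < =
    trans (cong (_+ offset c (pEnd d)) (sym (offset-qEnd d len<n)))
          (arc-trans-wrap n (pEnd<n c) (pEnd<n d) (qEnd<n d) <)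

  -- Seen from c, e ends before d starts. So if d and e cross, the p-end of e lies on the arc
  -- of d, and then the arcs of e, d and c together go once around the circle:
  -- n ≤ len e + len d + len c ≤ 3ω − 3.
  q-inside<p-inside⇒¬Intersect :
    3 * ω ∸ 3 < n → ∀ {c d e} →
    offset c (pEnd d) ≤ len c → len c < offset c (qEnd d) →
    offset c (qEnd e) < len c → len c < offset c (pEnd e) →
    offset c (qEnd e) < offset c (pEnd d) → ¬ Intersect d e
  q-inside<p-inside⇒¬Intersect _ {c} {d} {e} aᵈ≤j _ _ j<aᵉ _ (inj₁ coincide) =
    <⇒≱ (≤-<-trans aᵈ≤j j<aᵉ)
        (≤-reflexive (cong (offset c) (sym (proj₁ (coincide⇒≡ends {d} {e} coincide)))))
  q-inside<p-inside⇒¬Intersect n>3ω-3 {c} {d} {e} aᵈ≤j j<bᵈ bᵉ<j j<aᵉ bᵉ<aᵈ (inj₂ cross) =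
    impossible (cross⇒arc-separates {d} {e} (len<n n>3ω-3 d) cross)
    where
    j  = len c
    aᵈ = offset c (pEnd d)
    bᵈ = offset c (qEnd d)
    aᵉ = offset c (pEnd e)
    bᵉ = offset c (qEnd e)
    impossible : Xor (offset d (pEnd e) ≤ len d) (offset d (qEnd e) < len d) → ⊥
    impossible (inj₁ (u≤lenᵈ , _)) = <⇒≱ n>3ω-3 (begin
      n                          ≤⟨ m≤n+m n bᵉ ⟩
      bᵉ + n                     ≡⟨ len+offset-wrap {c} {e} (len<n n>3ω-3 e) (<-trans bᵉ<j j<aᵉ) ⟨
      len e + aᵉ                 ≡⟨ cong (len e +_) u+aᵈ ⟨
      len e + (u + aᵈ)           ≤⟨ +-monoʳ-≤ (len e) (+-mono-≤ u≤lenᵈ aᵈ≤j) ⟩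
      len e + (len d + j)        ≡⟨ +-assoc (len e) (len d) j ⟨
      len e + len d + j          ≤⟨ m,n,o<ω⇒m+n+o≤3ω∸3 (len<ω e) (len<ω d) (len<ω c) ⟩
      3 * ω ∸ 3                  ∎)
      where
      open ≤-Reasoning
      u = offset d (pEnd e)
      u+aᵈ : u + aᵈ ≡ aᵉ
      u+aᵈ = arc-trans n (pEnd<n c) (pEnd<n d) (pEnd<n e) (<⇒≤ (≤-<-trans aᵈ≤j j<aᵉ))
    impossible (inj₂ (_ , t<lenᵈ)) = <-irrefl refl (begin-strict
      t + aᵈ                     <⟨ +-monoˡ-< aᵈ t<lenᵈ ⟩
      len d + aᵈ                 ≡⟨ len+offset {c} {d} (len<n n>3ω-3 d) (<⇒≤ (≤-<-trans aᵈ≤j j<bᵈ)) ⟩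
      bᵈ                         <⟨ arc<M n (pEnd<n c) (qEnd<n d) ⟩
      n                          ≤⟨ m≤n+m n bᵉ ⟩
      bᵉ + n                     ≡⟨ t+aᵈ ⟨
      t + aᵈ                     ∎)
      where
      open ≤-Reasoning
      t = offset d (qEnd e)
      t+aᵈ : t + aᵈ ≡ bᵉ + n
      t+aᵈ = arc-trans-wrap n (pEnd<n c) (pEnd<n d) (qEnd<n e) bᵉ<aᵈ

  data Meeting (c d : Chord n ω) : Set where
    coincident : Coincide c d → Meeting c d
    p-inside   : 0 < offset c (pEnd d) → offset c (pEnd d) ≤ len c → len c < offset c (qEnd d) →
                 Meeting c d
    q-inside   : offset c (qEnd d) < len c → len c < offset c (pEnd d) → Meeting c d

  intersect⇒meeting : ∀ {c d} → len c < n → Intersect c d → Meeting c d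
  intersect⇒meeting _ (inj₁ coincide) = coincident coincide
  intersect⇒meeting {c} {d} len<n (inj₂ cross@(p≢ , q≢ , _))
    with cross⇒arc-separates {c} {d} len<n cross
  ... | inj₁ (a≤j , b≮j) = p-inside (n≢0⇒n>0 (p≢ ∘ cong (2 *_) ∘ ≡pEnd)) a≤j
                                    (≤∧≢⇒< (≮⇒≥ b≮j) (q≢ ∘ cong (λ z → 2 * z + 1) ∘ ≡qEnd))
    where
    ≡pEnd : offset c (pEnd d) ≡ 0 → pEnd c ≡ pEnd d
    ≡pEnd eq =
      offset-injective c (pEnd<n c) (pEnd<n d) (trans (arc-self n (<⇒≤ (pEnd<n c))) (sym eq))
    ≡qEnd : len c ≡ offset c (qEnd d) → qEnd c ≡ qEnd d
    ≡qEnd eq = offset-injective c (qEnd<n c) (qEnd<n d) (trans (offset-qEnd c len<n) eq)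
  ... | inj₂ (a≰j , b<j) = q-inside b<j (≰⇒> a≰j)

  -- A p-end at offset a and a q-end at offset a − 1 are neighbours on the circle, so they
  -- share the slot a.
  slot : ∀ {c d} → Meeting c d → ℕ
  slot         (coincident _)   = 0
  slot {c} {d} (p-inside _ _ _) = offset c (pEnd d)
  slot {c} {d} (q-inside _ _)   = suc (offset c (qEnd d))

  slot≤len : ∀ {c d} (μ : Meeting c d) → slot μ ≤ len c
  slot≤len (coincident _)     = z≤n
  slot≤len (p-inside _ a≤j _) = a≤j
  slot≤len (q-inside b<j _)   = b<j

  same-slot⇒coincide : 3 * ω ∸ 3 < n → ∀ {c d e} (μ : Meeting c d) (ν : Meeting c e) →
                       Intersect d e → Intersect e d → slot μ ≡ slot ν → Coincide d e
  same-slot⇒coincide _ (coincident (p≡ , q≡)) (coincident (p≡′ , q≡′)) _ _ _ =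
    trans (sym p≡) p≡′ , trans (sym q≡) q≡′
  same-slot⇒coincide _ (coincident _) (p-inside 0<a _ _) _ _ 0≡a = contradiction 0≡a (<⇒≢ 0<a)
  same-slot⇒coincide _ (p-inside 0<a _ _) (coincident _) _ _ a≡0 = contradiction (sym a≡0) (<⇒≢ 0<a)
  same-slot⇒coincide _ (coincident _) (q-inside _ _) _ _ ()
  same-slot⇒coincide _ (q-inside _ _) (coincident _) _ _ ()
  same-slot⇒coincide _ {c} {d} {e} (p-inside _ _ _) (p-inside _ _ _) d∩e _ eq =
    ≡pEnd⇒coincide {d} {e} d∩e (offset-injective c (pEnd<n d) (pEnd<n e) eq)
  same-slot⇒coincide _ {c} {d} {e} (q-inside _ _) (q-inside _ _) d∩e _ eq =
    ≡qEnd⇒coincide {d} {e} d∩e (offset-injective c (qEnd<n d) (qEnd<n e) (suc-injective eq))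
  same-slot⇒coincide n>3ω-3 {c} {d} {e} (p-inside _ a≤j j<b) (q-inside b<j j<a) d∩e _ eq =
    contradiction d∩e
      (q-inside<p-inside⇒¬Intersect n>3ω-3 {c} {d} {e} a≤j j<b b<j j<a (≤-reflexive (sym eq)))
  same-slot⇒coincide n>3ω-3 {c} {d} {e} (q-inside b<j j<a) (p-inside _ a≤j j<b) _ e∩d eq =
    contradiction e∩d
      (q-inside<p-inside⇒¬Intersect n>3ω-3 {c} {e} {d} a≤j j<b b<j j<a (≤-reflexive eq))

argmin : ∀ {k} (g : Fin (suc k) → ℕ) → Σ (Fin (suc k)) λ i → ∀ x → g i ≤ g x
argmin {zero}  g = F.zero , λ { F.zero → ≤-refl }
argmin {suc k} g with argmin (g ∘ F.suc)
... | i , min with g F.zero ≤? g (F.suc i)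
...   | yes ≤ᵢ = F.zero  , λ { F.zero → ≤-refl ; (F.suc x) → ≤-trans ≤ᵢ (min x) }
...   | no  ≰ᵢ = F.suc i , λ { F.zero → <⇒≤ (≰⇒> ≰ᵢ) ; (F.suc x) → min x }

module _ {ω m : ℕ} (n>3ω-3 : 3 * ω ∸ 3 < suc m) (f : Fin (suc ω) → Chord (suc m) ω)
         (pairwise : ∀ a b → a ≢ b → Intersect (f a) (f b)) where
  private
    shortest : Σ (Fin (suc ω)) λ i → ∀ x → len (f i) ≤ len (f x)
    shortest = argmin (len ∘ f)

    c : Chord (suc m) ω
    c = f (proj₁ shortest)

    j : ℕ
    j = len c

    meeting : ∀ x → Meeting c (f x)
    meeting x with proj₁ shortest Fₚ.≟ x
    ... | yes refl = coincident (refl , refl)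
    ... | no  i≢x  = intersect⇒meeting (len<n n>3ω-3 c) (pairwise _ x i≢x)

    slot-label : ∀ x → Fin (suc j)
    slot-label x = fromℕ< (s≤s (slot≤len (meeting x)))

    copy-label : ∀ x → Fin (ω / suc j)
    copy-label x = inject≤ (copy (f x)) (/-monoʳ-≤ ω (s≤s (proj₂ shortest x)))

  label : Fin (suc ω) → Fin ω
  label x = inject≤ (combine (slot-label x) (copy-label x))
                    (subst (_≤ ω) (*-comm (ω / suc j) (suc j)) (m/n*n≤m ω (suc j)))

  label-injective : ∀ {x y} → label x ≡ label y → f x ≡ f y
  label-injective {x} {y} eq with x Fₚ.≟ y
  ... | yes refl = refl
  ... | no  x≢y  = coincide⇒≡ n>3ω-3 coincide same-copy
    where
    same-pair : slot-label x ≡ slot-label y × copy-label x ≡ copy-label y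
    same-pair = Fₚ.combine-injective _ _ _ _ (Fₚ.inject≤-injective _ _ _ _ eq)
    coincide : Coincide (f x) (f y)
    coincide = same-slot⇒coincide n>3ω-3 (meeting x) (meeting y)
      (pairwise x y x≢y) (pairwise y x (x≢y ∘ sym))
      (Fₚ.fromℕ<-injective _ _ _ _ (proj₁ same-pair))
    same-copy : toℕ (copy (f x)) ≡ toℕ (copy (f y))
    same-copy = trans (sym (Fₚ.toℕ-inject≤ _ _))
                      (trans (cong toℕ (proj₂ same-pair)) (Fₚ.toℕ-inject≤ _ _))

lemma14 : (ω n : ℕ) → 1 ≤ ω → 3 * ω ∸ 3 < n →
          (f : Fin (suc ω) → Chord n ω) → Injective _≡_ _≡_ f →
          ¬ (∀ a b → a ≢ b → Intersect (f a) (f b))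
lemma14 ω zero _ _ f _ _ with start (f F.zero)
... | ()
lemma14 ω (suc m) _ n>3ω-3 f f-injective pairwise
  with i , k , i<k , labelᵢ≡labelₖ ← Fₚ.pigeonhole (n<1+n ω) (label n>3ω-3 f pairwise)
  = Fₚ.<-irrefl (f-injective (label-injective n>3ω-3 f pairwise labelᵢ≡labelₖ)) i<k
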